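{- Let $q$ be a prime power, let $S$ be a hyperplane of $\mathrm{PG}(5,q)$ and let $X$ be a point of $S$. Let $\mathcal{L}$ be a set of lines of $\mathrm{PG}(5,q)$ such that no line of $\mathcal{L}$ is contained in $S$, no line of $\mathcal{L}$ passes through $X$, no two lines of $\mathcal{L}$ meet in a point outside $S$, and $|\mathcal{L}|<q^{3}$. Then there exists a line through $X$, not contained in $S$, which is skew to every line of $\mathcal{L}$.
   Context: $\mathrm{PG}(5,q)$ denotes the $5$-dimensional projective space over the finite field $\mathrm{GF}(q)$. Two lines are skew if they have no common point. -}

module Defs where

open import Level using (Level; _⊔_)
open import Algebra.Bundles using (CommutativeRing)
open import Data.Nat using (ℕ)
open import Data.Fin using (Fin; zero; suc)
open import Data.Product using (Σ; ∃; _×_)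
open import Relation.Nullary using (¬_)
open import Relation.Binary.PropositionalEquality using (_≡_)

-- A finite field with `size` elements (size = q, necessarily a prime power).
-- The stdlib has no Field bundle, so: a commutative ring with 0 ≠ 1 in which
-- every nonzero element has a multiplicative inverse, whose carrier is in
-- bijection (up to the ring's equality ≈) with Fin size.
record FiniteField (c ℓ : Level) : Set (Level.suc (c ⊔ ℓ)) where
  field
    commutativeRing : CommutativeRing c ℓ
  open CommutativeRing commutativeRing public
  field
    0≉1      : ¬ (0# ≈ 1#)
    inverse  : ∀ x → ¬ (x ≈ 0#) → Σ Carrier (λ y → x * y ≈ 1#)
    size     : ℕ
    enum     : Fin size → Carrier
    enum-surj : ∀ x → ∃ (λ i → enum i ≈ x)
    enum-inj  : ∀ i j → enum i ≈ enum j → i ≡ j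

-- The projective space PG(5,F): points are the 1-dimensional subspaces of F^6,
-- represented by nonzero vectors; lines are 2-dimensional subspaces, represented
-- by a pair of linearly independent spanning vectors; hyperplanes are the
-- kernels of nonzero linear functionals.
module PG5 {c ℓ : Level} (F : FiniteField c ℓ) where
  open FiniteField F using (Carrier; _≈_; _+_; _*_; 0#)

  V6 : Set c
  V6 = Fin 6 → Carrier

  sumFin : ∀ n → (Fin n → Carrier) → Carrier
  sumFin ℕ.zero    f = 0#
  sumFin (ℕ.suc n) f = f zero + sumFin n (λ i → f (suc i))

  Nonzero : V6 → Set ℓ
  Nonzero x = ¬ (∀ i → x i ≈ 0#)

  record Line : Set (c ⊔ ℓ) where
    field
      u v   : V6
      indep : ∀ a b → (∀ i → a * u i + b * v i ≈ 0#) → (a ≈ 0#) × (b ≈ 0#)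

  OnLine : V6 → Line → Set (c ⊔ ℓ)
  OnLine p L = Σ Carrier λ a → Σ Carrier λ b → ∀ i → p i ≈ a * u i + b * v i
    where open Line L

  record Hyperplane : Set (c ⊔ ℓ) where
    field
      coeff   : V6
      nonzero : Nonzero coeff

  InHyp : Hyperplane → V6 → Set ℓ
  InHyp S x = sumFin 6 (λ i → Hyperplane.coeff S i * x i) ≈ 0#

  LineInHyp : Hyperplane → Line → Set (c ⊔ ℓ)
  LineInHyp S L = ∀ p → Nonzero p → OnLine p L → InHyp S p

  MeetOutside : Hyperplane → Line → Line → Set (c ⊔ ℓ)
  MeetOutside S L M = Σ V6 λ p → Nonzero p × OnLine p L × OnLine p M × ¬ InHyp S p

  Skew : Line → Line → Set (c ⊔ ℓ)
  Skew L M = ¬ (Σ V6 λ p → Nonzero p × OnLine p L × OnLine p M)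

module Submission where

-- Let φ be the linear functional defining S, so S is the set of points with
-- φ = 0 and X ∈ S.  Every point P off S (normalised to φ P = 1) gives the line
-- XP through X, not contained in S.  If XP meets a line L of 𝓛, then, as X is
-- not on L, P lies in the 3-space spanned by X and L.  Choosing a basis A, B
-- of L with φ B ≠ 0 (possible since L ⊄ S), such a P = αX + βA + γB is fixed
-- by (α, β) alone, because φ P = 1 forces γ.  So the lines of 𝓛 block at most
-- |𝓛| · q² normalised points, fewer than the q⁵ normalised points available.
--
-- To count with functions on Fin, the normalised points are enumerated as the
-- images of all q⁶ vectors x under the chart x ↦ x + t·e_k (t chosen so that
-- φ = 1, with φ(e_k) ≠ 0).  A blocked image is encoded by (i, α, β, x_k) in
-- a set of size |𝓛| · q³ < q⁶, and the code is injective; by pigeonhole some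
-- image P is unblocked and XP is the required line.

open import Defs
open import Level using (Level)
open import Data.Nat using (ℕ; _<_; _^_)
open import Data.Fin using (Fin)
open import Data.Product using (Σ; _×_)
open import Relation.Nullary using (¬_)
open import Relation.Binary.PropositionalEquality using (_≢_)

open import Level using (_⊔_)
import Data.Nat as ℕ
import Data.Nat.Properties as ℕ
open import Data.Fin using (zero; suc; combine; finToFun; funToFin)
open import Data.Fin.Properties
  using (any?; all?; ¬∀⟶∃¬; combine-injective; funToFin-finToFin; <⇒notInjective)
open import Data.Product using (_,_; proj₁; proj₂; ∃)
open import Data.Empty using (⊥-elim)
open import Function using (_∘_)
open import Relation.Nullary using (Dec; yes; no; ¬?; decidable-stable)
import Relation.Binary.PropositionalEquality as Eq
open Eq using (_≡_)

codes<q⁶ : ∀ n q → n < q ^ 3 → n ℕ.* (q ℕ.* (q ℕ.* q)) < q ^ 6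
codes<q⁶ n q n<q³ =
  Eq.subst₂ _<_ (Eq.cong (n ℕ.*_) q³≡) q³q³≡q⁶
    (ℕ.*-monoˡ-< (q ^ 3) {{ℕ.>-nonZero (ℕ.m<n⇒0<n n<q³)}} n<q³)
  where
  q³≡ : q ^ 3 ≡ q ℕ.* (q ℕ.* q)
  q³≡ = Eq.cong (λ x → q ℕ.* (q ℕ.* x)) (ℕ.*-identityʳ q)
  q³q³≡q⁶ : q ^ 3 ℕ.* q ^ 3 ≡ q ^ 6
  q³q³≡q⁶ = Eq.sym (ℕ.^-distribˡ-+-* q 3 3)

funToFin-cong : ∀ {a b} {f g : Fin a → Fin b} → (∀ j → f j ≡ g j) → funToFin f ≡ funToFin g
funToFin-cong {ℕ.zero}  f≗g = Eq.refl
funToFin-cong {ℕ.suc a} f≗g = Eq.cong₂ combine (f≗g zero) (funToFin-cong (f≗g ∘ suc))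

finToFun-injective : ∀ {a b} (m m′ : Fin (b ^ a)) →
                     (∀ j → finToFun {b} {a} m j ≡ finToFun m′ j) → m ≡ m′
finToFun-injective {a} {b} m m′ m≗m′ =
  Eq.trans (Eq.sym (funToFin-finToFin {a} {b} m))
    (Eq.trans (funToFin-cong m≗m′) (funToFin-finToFin {a} {b} m′))

module FieldFacts {c ℓ : Level} (F : FiniteField c ℓ) where
  open FiniteField F hiding (zero)
  open import Relation.Binary.Reasoning.Setoid setoid
  open import Algebra.Solver.Ring.NaturalCoefficients.Default commutativeSemiring

  index : Carrier → Fin size
  index x = proj₁ (enum-surj x)

  enum-index : ∀ x → enum (index x) ≈ x
  enum-index x = proj₂ (enum-surj x)

  _≈?_ : ∀ x y → Dec (x ≈ y)
  x ≈? y with index x Data.Fin.≟ index y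
  ... | yes i≡j = yes (trans (sym (enum-index x)) (trans (reflexive (Eq.cong enum i≡j)) (enum-index y)))
  ... | no  i≢j = no λ x≈y → i≢j (enum-inj _ _ (trans (enum-index x) (trans x≈y (sym (enum-index y)))))

  1≉0 : ¬ 1# ≈ 0#
  1≉0 = 0≉1 ∘ sym

  inv : ∀ a → ¬ a ≈ 0# → Carrier
  inv a a≉0 = proj₁ (inverse a a≉0)

  inv-inverse : ∀ a (a≉0 : ¬ a ≈ 0#) → a * inv a a≉0 ≈ 1#
  inv-inverse a a≉0 = proj₂ (inverse a a≉0)

  divide-out : ∀ a (a≉0 : ¬ a ≈ 0#) x → x ≈ inv a a≉0 * (a * x)
  divide-out a a≉0 x = begin
    x                      ≈⟨ sym (*-identityˡ x) ⟩
    1# * x                 ≈⟨ *-cong (sym (inv-inverse a a≉0)) refl ⟩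
    (a * inv a a≉0) * x    ≈⟨ *-cong (*-comm a _) refl ⟩
    (inv a a≉0 * a) * x    ≈⟨ *-assoc _ a x ⟩
    inv a a≉0 * (a * x)    ∎

  nonzero-factor : ∀ {a x} → ¬ a ≈ 0# → a * x ≈ 0# → x ≈ 0#
  nonzero-factor {a} {x} a≉0 ax≈0 = begin
    x                   ≈⟨ divide-out a a≉0 x ⟩
    inv a a≉0 * (a * x) ≈⟨ *-cong refl ax≈0 ⟩
    inv a a≉0 * 0#      ≈⟨ zeroʳ _ ⟩
    0#                  ∎

  *-cancelʳ-nonzero : ∀ {a b d} → ¬ d ≈ 0# → a * d ≈ b * d → a ≈ b
  *-cancelʳ-nonzero {a} {b} {d} d≉0 ad≈bd = begin
    a                   ≈⟨ divide-out d d≉0 a ⟩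
    inv d d≉0 * (d * a) ≈⟨ *-cong refl (trans (*-comm d a) (trans ad≈bd (*-comm b d))) ⟩
    inv d d≉0 * (d * b) ≈⟨ divide-out d d≉0 b ⟨
    b                   ∎

  *-distrib-combination : ∀ a b x d y → a * (b * x + d * y) ≈ (a * b) * x + (a * d) * y
  *-distrib-combination a b x d y = begin
    a * (b * x + d * y)         ≈⟨ distribˡ a _ _ ⟩
    a * (b * x) + a * (d * y)   ≈⟨ +-cong (sym (*-assoc a b x)) (sym (*-assoc a d y)) ⟩
    (a * b) * x + (a * d) * y   ∎

  isolate : ∀ {a b x y z} (b≉0 : ¬ b ≈ 0#) → z ≈ a * x + b * y →
            y ≈ (inv b b≉0 * - a) * x + inv b b≉0 * z
  isolate {a} {b} {x} {y} {z} b≉0 z≈ax+by = begin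
    y                                  ≈⟨ divide-out b b≉0 y ⟩
    b⁻¹ * (b * y)                      ≈⟨ *-cong refl (sym (+-identityˡ _)) ⟩
    b⁻¹ * (0# + b * y)                 ≈⟨ *-cong refl (+-cong (sym (-a·x+a·x≈0)) refl) ⟩
    b⁻¹ * ((- a) * x + a * x + b * y)  ≈⟨ regroup ⟩
    (b⁻¹ * - a) * x + b⁻¹ * (a * x + b * y) ≈⟨ +-cong refl (*-cong refl (sym z≈ax+by)) ⟩
    (b⁻¹ * - a) * x + b⁻¹ * z          ∎
    where
    b⁻¹ : Carrier
    b⁻¹ = inv b b≉0
    -a·x+a·x≈0 : (- a) * x + a * x ≈ 0#
    -a·x+a·x≈0 = trans (sym (distribʳ x (- a) a)) (trans (*-cong (-‿inverseˡ a) refl) (zeroˡ x))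
    regroup : b⁻¹ * ((- a) * x + a * x + b * y) ≈ (b⁻¹ * - a) * x + b⁻¹ * (a * x + b * y)
    regroup = solve 6 (λ i n a x b y → i :* (n :* x :+ a :* x :+ b :* y) := (i :* n) :* x :+ i :* (a :* x :+ b :* y))
                refl b⁻¹ (- a) a x b y

module Vectors {c ℓ : Level} (F : FiniteField c ℓ) where
  open FiniteField F hiding (zero)
  open PG5 F using (sumFin)
  open FieldFacts F
  open import Relation.Binary.Reasoning.Setoid setoid
  open import Algebra.Properties.CommutativeSemigroup +-commutativeSemigroup using (interchange)
  open import Algebra.Properties.CommutativeSemigroup *-commutativeSemigroup using (x∙yz≈y∙xz)
  open import Algebra.Properties.Ring ring using (+-cancelˡ; +-cancelʳ)
  open import Algebra.Solver.Ring.NaturalCoefficients.Default commutativeSemiring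

  Vec : ℕ → Set c
  Vec d = Fin d → Carrier

  infixl 6 _⊕_
  infixr 7 _·_
  infix  4 _≋_

  _⊕_ : ∀ {d} → Vec d → Vec d → Vec d
  (x ⊕ y) i = x i + y i

  _·_ : ∀ {d} → Carrier → Vec d → Vec d
  (a · x) i = a * x i

  _≋_ : ∀ {d} → Vec d → Vec d → Set ℓ
  x ≋ y = ∀ i → x i ≈ y i

  IsNull : ∀ {d} → Vec d → Set ℓ
  IsNull x = ∀ i → x i ≈ 0#

  unit : ∀ {d} → Fin d → Vec d
  unit zero    zero    = 1#
  unit zero    (suc j) = 0#
  unit (suc k) zero    = 0#
  unit (suc k) (suc j) = unit k j

  unit-diag : ∀ {d} (k : Fin d) → unit k k ≈ 1#
  unit-diag zero    = refl
  unit-diag (suc k) = unit-diag k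

  annihilator-zero : ∀ {d} {a} {x : Vec d} → ¬ IsNull x → IsNull (a · x) → a ≈ 0#
  annihilator-zero {a = a} x≠0 ax≈0 with a ≈? 0#
  ... | yes a≈0 = a≈0
  ... | no  a≉0 = ⊥-elim (x≠0 λ i → nonzero-factor a≉0 (ax≈0 i))

  dot : ∀ {d} → Vec d → Vec d → Carrier
  dot {d} w x = sumFin d (λ i → w i * x i)

  dot-cong : ∀ {d} (w : Vec d) {x y : Vec d} → x ≋ y → dot w x ≈ dot w y
  dot-cong {ℕ.zero}  w x≋y = refl
  dot-cong {ℕ.suc d} w x≋y = +-cong (*-cong refl (x≋y zero)) (dot-cong (w ∘ suc) (x≋y ∘ suc))

  dot-null : ∀ {d} (w x : Vec d) → IsNull x → dot w x ≈ 0#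
  dot-null {ℕ.zero}  w x x≈0 = refl
  dot-null {ℕ.suc d} w x x≈0 = begin
    w zero * x zero + dot (w ∘ suc) (x ∘ suc) ≈⟨ +-cong (*-cong refl (x≈0 zero)) (dot-null (w ∘ suc) (x ∘ suc) (x≈0 ∘ suc)) ⟩
    w zero * 0# + 0#                          ≈⟨ +-identityʳ _ ⟩
    w zero * 0#                               ≈⟨ zeroʳ _ ⟩
    0#                                        ∎

  dot-⊕ : ∀ {d} (w x y : Vec d) → dot w (x ⊕ y) ≈ dot w x + dot w y
  dot-⊕ {ℕ.zero}  w x y = sym (+-identityʳ 0#)
  dot-⊕ {ℕ.suc d} w x y = begin
    w zero * (x zero + y zero) + dot w′ (x′ ⊕ y′)
      ≈⟨ +-cong (distribˡ (w zero) _ _) (dot-⊕ w′ x′ y′) ⟩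
    (w zero * x zero + w zero * y zero) + (dot w′ x′ + dot w′ y′)
      ≈⟨ interchange _ _ _ _ ⟩
    (w zero * x zero + dot w′ x′) + (w zero * y zero + dot w′ y′) ∎
    where
    w′ x′ y′ : Vec d
    w′ = w ∘ suc
    x′ = x ∘ suc
    y′ = y ∘ suc

  dot-· : ∀ {d} (w : Vec d) a (x : Vec d) → dot w (a · x) ≈ a * dot w x
  dot-· {ℕ.zero}  w a x = sym (zeroʳ a)
  dot-· {ℕ.suc d} w a x = begin
    w zero * (a * x zero) + dot (w ∘ suc) (a · (x ∘ suc))
      ≈⟨ +-cong (x∙yz≈y∙xz _ _ _) (dot-· (w ∘ suc) a (x ∘ suc)) ⟩
    a * (w zero * x zero) + a * dot (w ∘ suc) (x ∘ suc)
      ≈⟨ distribˡ a _ _ ⟨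
    a * (w zero * x zero + dot (w ∘ suc) (x ∘ suc)) ∎

  dot-unit : ∀ {d} (w : Vec d) (k : Fin d) → dot w (unit k) ≈ w k
  dot-unit {ℕ.suc d} w zero = begin
    w zero * 1# + dot (w ∘ suc) (λ _ → 0#) ≈⟨ +-cong (*-identityʳ _) (dot-null (w ∘ suc) _ (λ _ → refl)) ⟩
    w zero + 0#                            ≈⟨ +-identityʳ _ ⟩
    w zero                                 ∎
  dot-unit {ℕ.suc d} w (suc k) = begin
    w zero * 0# + dot (w ∘ suc) (unit k) ≈⟨ +-cong (zeroʳ _) (dot-unit (w ∘ suc) k) ⟩
    0# + w (suc k)                       ≈⟨ +-identityˡ _ ⟩
    w (suc k)                            ∎

  dot-combination₂ : ∀ {d} (w : Vec d) a x b y → dot w (a · x ⊕ b · y) ≈ a * dot w x + b * dot w y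
  dot-combination₂ w a x b y = trans (dot-⊕ w _ _) (+-cong (dot-· w a x) (dot-· w b y))

  dot-combination₃ : ∀ {d} (w : Vec d) a x b y g z →
                     dot w (a · x ⊕ b · y ⊕ g · z) ≈ a * dot w x + b * dot w y + g * dot w z
  dot-combination₃ w a x b y g z = trans (dot-⊕ w _ _) (+-cong (dot-combination₂ w a x b y) (dot-· w g z))

  last-coefficient-determined : ∀ {d} (w : Vec d) {a b g g′} x y z → ¬ dot w z ≈ 0# →
    dot w (a · x ⊕ b · y ⊕ g · z) ≈ dot w (a · x ⊕ b · y ⊕ g′ · z) → g ≈ g′
  last-coefficient-determined w {a} {b} {g} {g′} x y z wz≉0 same =
    *-cancelʳ-nonzero wz≉0 (+-cancelˡ (a * dot w x + b * dot w y) _ _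
      (trans (sym (dot-combination₃ w a x b y g z)) (trans same (dot-combination₃ w a x b y g′ z))))

  -- Membership in the span of three vectors, with coefficients given by their
  -- positions in the enumeration of F, so that it is decidable and countable.
  InSpan₃ : ∀ {d} → Vec d → Vec d → Vec d → Vec d → Set ℓ
  InSpan₃ x y z p = Σ (Fin size) λ α → Σ (Fin size) λ β → Σ (Fin size) λ γ →
                    p ≋ enum α · x ⊕ enum β · y ⊕ enum γ · z

  inSpan₃? : ∀ {d} (x y z p : Vec d) → Dec (InSpan₃ x y z p)
  inSpan₃? x y z p = any? λ α → any? λ β → any? λ γ → all? λ i →
                     p i ≈? (enum α · x ⊕ enum β · y ⊕ enum γ · z) i

  inSpan₃-intro : ∀ {d} {x y z p : Vec d} a b g → p ≋ a · x ⊕ b · y ⊕ g · z → InSpan₃ x y z p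
  inSpan₃-intro a b g p≋ = index a , index b , index g , λ i →
    trans (p≋ i) (+-cong (+-cong (*-cong (sym (enum-index a)) refl) (*-cong (sym (enum-index b)) refl))
                         (*-cong (sym (enum-index g)) refl))

  module Chart {d : ℕ} (w : Vec d) (k : Fin d) (wk≉0 : ¬ w k ≈ 0#) where
    shift : Vec d → Carrier
    shift x = inv (w k) wk≉0 * (1# - dot w x)

    chart : Vec d → Vec d
    chart x = x ⊕ shift x · unit k

    dot-chart : ∀ x → dot w (chart x) ≈ 1#
    dot-chart x = begin
      dot w (x ⊕ shift x · unit k)            ≈⟨ dot-⊕ w x _ ⟩
      dot w x + dot w (shift x · unit k)      ≈⟨ +-cong refl (dot-· w (shift x) (unit k)) ⟩
      dot w x + shift x * dot w (unit k)      ≈⟨ +-cong refl (*-cong refl (dot-unit w k)) ⟩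
      dot w x + (w⁻¹ * r) * w k               ≈⟨ +-cong refl (solve 3 (λ i r v → (i :* r) :* v := r :* (v :* i)) refl w⁻¹ r (w k)) ⟩
      dot w x + r * (w k * w⁻¹)               ≈⟨ +-cong refl (*-cong refl (inv-inverse (w k) wk≉0)) ⟩
      dot w x + r * 1#                        ≈⟨ +-cong refl (*-identityʳ r) ⟩
      dot w x + (1# + - dot w x)              ≈⟨ solve 3 (λ y o n → y :+ (o :+ n) := o :+ (y :+ n)) refl (dot w x) 1# (- dot w x) ⟩
      1# + (dot w x + - dot w x)              ≈⟨ +-cong refl (-‿inverseʳ (dot w x)) ⟩
      1# + 0#                                 ≈⟨ +-identityʳ 1# ⟩
      1#                                      ∎
      where
      w⁻¹ r : Carrier
      w⁻¹ = inv (w k) wk≉0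
      r   = 1# - dot w x

    chart-injective : ∀ {x y} → chart x ≋ chart y → x k ≈ y k → x ≋ y
    chart-injective {x} {y} cx≋cy xk≈yk j =
      +-cancelʳ (shift x * unit k j) (x j) (y j)
        (trans (cx≋cy j) (+-cong refl (*-cong (sym same-shift) refl)))
      where
      same-shift : shift x ≈ shift y
      same-shift = *-cancelʳ-nonzero (λ e≈0 → 1≉0 (trans (sym (unit-diag k)) e≈0))
                     (+-cancelˡ (x k) _ _ (trans (cx≋cy k) (+-cong (sym xk≈yk) refl)))

module Geometry {c ℓ : Level} (F : FiniteField c ℓ) (S : PG5.Hyperplane F) where
  open FiniteField F hiding (zero)
  open PG5 F
  open FieldFacts F
  open Vectors F
  open import Relation.Binary.Reasoning.Setoid setoid
  open import Algebra.Solver.Ring.NaturalCoefficients.Default commutativeSemiring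

  w : V6
  w = Hyperplane.coeff S

  φ : V6 → Carrier
  φ = dot w

  spanned-in-S : (L : Line) → φ (Line.u L) ≈ 0# → φ (Line.v L) ≈ 0# → LineInHyp S L
  spanned-in-S L φu≈0 φv≈0 p _ (a , b , p≋) = begin
    φ p                     ≈⟨ dot-cong w p≋ ⟩
    φ (a · u ⊕ b · v)       ≈⟨ dot-combination₂ w a u b v ⟩
    a * φ u + b * φ v       ≈⟨ +-cong (*-cong refl φu≈0) (*-cong refl φv≈0) ⟩
    a * 0# + b * 0#         ≈⟨ +-cong (zeroʳ a) (zeroʳ b) ⟩
    0# + 0#                 ≈⟨ +-identityʳ 0# ⟩
    0#                      ∎
    where open Line L

  record AffineBasis (L : Line) : Set (c ⊔ ℓ) where
    field
      A B  : V6
      φB≉0 : ¬ φ B ≈ 0#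
      spans : ∀ p → OnLine p L → Σ Carrier λ a → Σ Carrier λ b → p ≋ a · A ⊕ b · B

  affineBasis : (L : Line) → ¬ LineInHyp S L → AffineBasis L
  affineBasis L L⊄S with φ (Line.v L) ≈? 0# | φ (Line.u L) ≈? 0#
  ... | no φv≉0  | _        = record { A = Line.u L ; B = Line.v L ; φB≉0 = φv≉0
                                     ; spans = λ p on → on }
  ... | yes _    | no φu≉0  = record { A = Line.v L ; B = Line.u L ; φB≉0 = φu≉0
                                     ; spans = λ { p (a , b , p≋) → b , a , λ i → trans (p≋ i) (+-comm _ _) } }
  ... | yes φv≈0 | yes φu≈0 = ⊥-elim (L⊄S (spanned-in-S L φu≈0 φv≈0))

  multiple-on-line : ∀ {p x a} (L : Line) → Nonzero p → p ≋ a · x → OnLine p L → OnLine x L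
  multiple-on-line {p} {x} {a} L p≠0 p≋ax (c , d , p≋) with a ≈? 0#
  ... | yes a≈0 = ⊥-elim (p≠0 λ i → trans (p≋ax i) (trans (*-cong a≈0 refl) (zeroˡ (x i))))
  ... | no  a≉0 = a⁻¹ * c , a⁻¹ * d , λ i → begin
    x i                               ≈⟨ divide-out a a≉0 (x i) ⟩
    a⁻¹ * (a * x i)                   ≈⟨ *-cong refl (sym (p≋ax i)) ⟩
    a⁻¹ * p i                         ≈⟨ *-cong refl (p≋ i) ⟩
    a⁻¹ * (c * Line.u L i + d * Line.v L i) ≈⟨ *-distrib-combination a⁻¹ c _ d _ ⟩
    (a⁻¹ * c) * Line.u L i + (a⁻¹ * d) * Line.v L i ∎
    where
    a⁻¹ : Carrier
    a⁻¹ = inv a a≉0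

  module Through (X : V6) (X≠0 : Nonzero X) (X∈S : InHyp S X) where

    off-S-nonzero : ∀ {P} → ¬ φ P ≈ 0# → Nonzero P
    off-S-nonzero {P} φP≉0 P≈0 = φP≉0 (dot-null w P P≈0)

    independent : ∀ {P} → ¬ φ P ≈ 0# → ∀ a b → IsNull (a · X ⊕ b · P) → (a ≈ 0#) × (b ≈ 0#)
    independent {P} φP≉0 a b null = a≈0 , b≈0
      where
      b≈0 : b ≈ 0#
      b≈0 = nonzero-factor φP≉0 (begin
        φ P * b                ≈⟨ *-comm _ b ⟩
        b * φ P                ≈⟨ +-identityˡ _ ⟨
        0# + b * φ P           ≈⟨ +-cong (trans (*-cong refl X∈S) (zeroʳ a)) refl ⟨
        a * φ X + b * φ P      ≈⟨ dot-combination₂ w a X b P ⟨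
        φ (a · X ⊕ b · P)      ≈⟨ dot-null w _ null ⟩
        0#                     ∎)
      a≈0 : a ≈ 0#
      a≈0 = annihilator-zero X≠0 λ i → begin
        a * X i                ≈⟨ +-identityʳ _ ⟨
        a * X i + 0#           ≈⟨ +-cong refl (trans (*-cong b≈0 refl) (zeroˡ (P i))) ⟨
        a * X i + b * P i      ≈⟨ null i ⟩
        0#                     ∎

    join : (P : V6) → ¬ φ P ≈ 0# → Line
    join P φP≉0 = record { u = X ; v = P ; indep = independent φP≉0 }

    X-on-join : ∀ P (φP≉0 : ¬ φ P ≈ 0#) → OnLine X (join P φP≉0)
    X-on-join P _ = 1# , 0# , λ i → solve 2 (λ x p → x := con 1 :* x :+ con 0 :* p) refl (X i) (P i)

    join-not-in-S : ∀ P (φP≉0 : ¬ φ P ≈ 0#) → ¬ LineInHyp S (join P φP≉0)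
    join-not-in-S P φP≉0 XP⊆S = φP≉0 (XP⊆S P (off-S-nonzero φP≉0) P-on-join)
      where
      P-on-join : OnLine P (join P φP≉0)
      P-on-join = 0# , 1# , λ i → solve 2 (λ x p → p := con 0 :* x :+ con 1 :* p) refl (X i) (P i)

    meet⇒inSpan : ∀ (L : Line) (β : AffineBasis L) → ¬ OnLine X L →
                  ∀ P (φP≉0 : ¬ φ P ≈ 0#) p → Nonzero p → OnLine p (join P φP≉0) → OnLine p L →
                  InSpan₃ X (AffineBasis.A β) (AffineBasis.B β) P
    meet⇒inSpan L β X∉L P φP≉0 p p≠0 (a , b , p≋aX+bP) p∈L with b ≈? 0#
    ... | yes b≈0 = ⊥-elim (X∉L (multiple-on-line L p≠0 p≋aX p∈L))
      where
      p≋aX : p ≋ a · X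
      p≋aX i = trans (p≋aX+bP i) (trans (+-cong refl (trans (*-cong b≈0 refl) (zeroˡ (P i)))) (+-identityʳ _))
    ... | no  b≉0 with AffineBasis.spans β p p∈L
    ...   | s , t , p≋sA+tB = inSpan₃-intro (b⁻¹ * - a) (b⁻¹ * s) (b⁻¹ * t) λ i → begin
      P i                                         ≈⟨ isolate b≉0 (p≋aX+bP i) ⟩
      (b⁻¹ * - a) * X i + b⁻¹ * p i               ≈⟨ +-cong refl (*-cong refl (p≋sA+tB i)) ⟩
      (b⁻¹ * - a) * X i + b⁻¹ * (s * A i + t * B i) ≈⟨ +-cong refl (*-distrib-combination b⁻¹ s (A i) t (B i)) ⟩
      (b⁻¹ * - a) * X i + ((b⁻¹ * s) * A i + (b⁻¹ * t) * B i) ≈⟨ +-assoc _ _ _ ⟨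
      (b⁻¹ * - a) * X i + (b⁻¹ * s) * A i + (b⁻¹ * t) * B i   ∎
      where
      open AffineBasis β using (A; B)
      b⁻¹ : Carrier
      b⁻¹ = inv b b≉0

    module Count (n : ℕ) (L : Fin n → Line) (L⊄S : ∀ i → ¬ LineInHyp S (L i))
                 (X∉L : ∀ i → ¬ OnLine X (L i)) (n<q³ : n < size ^ 3) where

      basis : ∀ i → AffineBasis (L i)
      basis i = affineBasis (L i) (L⊄S i)

      Blocked : V6 → Set ℓ
      Blocked P = Σ (Fin n) λ i → InSpan₃ X (AffineBasis.A (basis i)) (AffineBasis.B (basis i)) P

      blocked? : ∀ P → Dec (Blocked P)
      blocked? P = any? λ i → inSpan₃? _ _ _ P

      unblocked⇒skew : ∀ P (φP≉0 : ¬ φ P ≈ 0#) → ¬ Blocked P → ∀ i → Skew (join P φP≉0) (L i)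
      unblocked⇒skew P φP≉0 free i (p , p≠0 , p∈XP , p∈L) =
        free (i , meet⇒inSpan (L i) (basis i) (X∉L i) P φP≉0 p p≠0 p∈XP p∈L)

      pivot : ∃ λ k → ¬ w k ≈ 0#
      pivot = ¬∀⟶∃¬ 6 (λ i → w i ≈ 0#) (λ i → w i ≈? 0#) (Hyperplane.nonzero S)

      open Chart w (proj₁ pivot) (proj₂ pivot)

      coordinates : Fin (size ^ 6) → V6
      coordinates m = enum ∘ finToFun m

      candidate : Fin (size ^ 6) → V6
      candidate m = chart (coordinates m)

      candidate-off-S : ∀ m → ¬ φ (candidate m) ≈ 0#
      candidate-off-S m φ≈0 = 1≉0 (trans (sym (dot-chart (coordinates m))) φ≈0)

      code : ∀ m → Blocked (candidate m) → Fin (n ℕ.* (size ℕ.* (size ℕ.* size)))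
      code m (i , α , β , _) = combine i (combine α (combine β (finToFun m (proj₁ pivot))))

      code-injective : ∀ m m′ b b′ → code m b ≡ code m′ b′ → m ≡ m′
      code-injective m m′ (i , α , β , γ , m≋) (i′ , α′ , β′ , γ′ , m′≋) same-code
        with combine-injective i _ i′ _ same-code
      ... | Eq.refl , same₁ with combine-injective α _ α′ _ same₁
      ... | Eq.refl , same₂ with combine-injective β _ β′ _ same₂
      ... | Eq.refl , same-pivot =
        finToFun-injective m m′ λ j → enum-inj _ _ (chart-injective same-candidate (reflexive (Eq.cong enum same-pivot)) j)
        where
        open AffineBasis (basis i)
        γ≈γ′ : enum γ ≈ enum γ′
        γ≈γ′ = last-coefficient-determined w X A B φB≉0
                 (trans (sym (dot-cong w m≋)) (trans (dot-chart (coordinates m)) (trans (sym (dot-chart (coordinates m′))) (dot-cong w m′≋))))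
        same-candidate : candidate m ≋ candidate m′
        same-candidate j = trans (m≋ j) (trans (+-cong refl (*-cong γ≈γ′ refl)) (sym (m′≋ j)))

      -- Pigeonhole: the codes are fewer than the candidates.
      some-unblocked : Σ (Fin (size ^ 6)) λ m → ¬ Blocked (candidate m)
      some-unblocked with any? (λ m → ¬? (blocked? (candidate m)))
      ... | yes found = found
      ... | no  none  = ⊥-elim (<⇒notInjective (codes<q⁶ n size n<q³)
                          λ {m} {m′} → code-injective m m′ (all-blocked m) (all-blocked m′))
        where
        all-blocked : ∀ m → Blocked (candidate m)
        all-blocked m = decidable-stable (blocked? (candidate m)) λ free → none (m , free)

mainTheorem1 : ∀ {c ℓ : Level} (F : FiniteField c ℓ) →
    let open PG5 F in
    (S : Hyperplane) (X : V6) → Nonzero X → InHyp S X →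
    (n : ℕ) (L : Fin n → Line) →
    (∀ i → ¬ LineInHyp S (L i)) →
    (∀ i → ¬ OnLine X (L i)) →
    (∀ i j → i ≢ j → ¬ MeetOutside S (L i) (L j)) →
    n < FiniteField.size F ^ 3 →
    Σ Line (λ M → OnLine X M × ¬ LineInHyp S M × (∀ i → Skew M (L i)))
mainTheorem1 F S X X≠0 X∈S n L L⊄S X∉L _ n<q³ =
  join P P∉S , X-on-join P P∉S , join-not-in-S P P∉S , unblocked⇒skew P P∉S P-unblocked
  where
  open FiniteField F using (_≈_; 0#; size)
  open PG5 F using (V6)
  open Geometry F S
  open Through X X≠0 X∈S
  open Count n L L⊄S X∉L n<q³
  m : Fin (size ^ 6)
  m = proj₁ some-unblocked
  P : V6
  P = candidate m
  P∉S : ¬ φ P ≈ 0#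
  P∉S = candidate-off-S m
  P-unblocked : ¬ Blocked P
  P-unblocked = proj₂ some-unblocked
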